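{- Let $k$ be a positive integer, let $T$ be a tree on $k+2$ vertices which is not a star, and let $G$ be a $k$-regular connected graph with girth at least $k+2$. If there exists a proper edge colouring of $G$ with no rainbow copy of $T$, then $G$ is $k$-edge-colourable.
   Context: All graphs are finite and simple. A proper edge colouring assigns colours to edges so that edges sharing a vertex receive distinct colours; $G$ is $k$-edge-colourable if it has a proper edge colouring using at most $k$ colours. A copy of $T$ in an edge-coloured graph is rainbow if all its edges have distinct colours. The girth of a graph is the length of its shortest cycle (infinite for forests). A star is a graph $K_{1,t}$. -}

module Defs where

open import Data.Nat using (ℕ; zero; suc; _+_; _≤_; _<_)
open import Data.Bool using (Bool; true; false; if_then_else_)
open import Data.Fin using (Fin; zero; suc; inject₁; fromℕ)
open import Data.List using (List; map; allFin)
open import Data.Nat.ListAction using (sum)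
open import Data.Empty using (⊥)
open import Data.Product using (Σ; _×_; _,_; ∃; ∃-syntax)
open import Data.Sum using (_⊎_)
open import Relation.Binary.PropositionalEquality using (_≡_; _≢_)
open import Relation.Nullary using (¬_)
open import Function using (_⇔_)
open import Function.Definitions using (Injective)

record Graph : Set where
  field
    n      : ℕ
    adj    : Fin n → Fin n → Bool
    sym    : ∀ u v → adj u v ≡ adj v u
    irrefl : ∀ u → adj u u ≡ false

open Graph public

Adj : (G : Graph) → Fin (n G) → Fin (n G) → Set
Adj G u v = adj G u v ≡ true

deg : (G : Graph) → Fin (n G) → ℕ
deg G u = sum (map (λ v → if adj G u v then 1 else 0) (allFin (n G)))

Regular : ℕ → Graph → Set
Regular k G = ∀ u → deg G u ≡ k

data Walk (G : Graph) : Fin (n G) → Fin (n G) → Set where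
  here : ∀ {u} → Walk G u u
  step : ∀ {u w v} → Adj G u w → Walk G w v → Walk G u v

Connected : Graph → Set
Connected G = ∀ u v → Walk G u v

-- a cycle of length (suc m) (meaningful for suc m ≥ 3): distinct vertices
-- f 0, f 1, ..., f m with f i ~ f (i+1) and f m ~ f 0.
CycleOfLength : (G : Graph) → ℕ → Set
CycleOfLength G zero = ⊥
CycleOfLength G (suc m) =
  Σ (Fin (suc m) → Fin (n G)) λ f →
    Injective _≡_ _≡_ f ×
    (∀ (i : Fin m) → Adj G (f (inject₁ i)) (f (suc i))) ×
    Adj G (f (fromℕ m)) (f zero)

GirthAtLeast : ℕ → Graph → Set
GirthAtLeast g G = ∀ ℓ → 3 ≤ ℓ → ℓ < g → ¬ CycleOfLength G ℓ

Acyclic : Graph → Set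
Acyclic G = ∀ ℓ → 3 ≤ ℓ → ¬ CycleOfLength G ℓ

IsTree : Graph → Set
IsTree G = Connected G × Acyclic G

IsStar : Graph → Set
IsStar G = ∃[ c ] (∀ u v → Adj G u v ⇔ (u ≢ v × (u ≡ c ⊎ v ≡ c)))

-- an edge colouring (colours in ℕ), symmetric on edges; values on
-- non-edges are irrelevant
Colouring : Graph → Set
Colouring G = Fin (n G) → Fin (n G) → ℕ

IsEdgeColouring : (G : Graph) → Colouring G → Set
IsEdgeColouring G c = ∀ u v → Adj G u v → c u v ≡ c v u

IsProper : (G : Graph) → Colouring G → Set
IsProper G c = IsEdgeColouring G c ×
  (∀ u v w → Adj G u v → Adj G u w → v ≢ w → c u v ≢ c u w)

EdgeColourable : ℕ → Graph → Set
EdgeColourable k G = Σ (Colouring G) λ c →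
  IsProper G c × (∀ u v → Adj G u v → c u v < k)

IsCopy : (T G : Graph) → (Fin (n T) → Fin (n G)) → Set
IsCopy T G φ = Injective _≡_ _≡_ φ × (∀ a b → Adj T a b → Adj G (φ a) (φ b))

IsRainbow : (T G : Graph) → Colouring G → (Fin (n T) → Fin (n G)) → Set
IsRainbow T G c φ = ∀ a b a' b' → Adj T a b → Adj T a' b' →
  c (φ a) (φ b) ≡ c (φ a') (φ b') →
  (a ≡ a' × b ≡ b') ⊎ (a ≡ b' × b ≡ a')

HasRainbowCopy : (T G : Graph) → Colouring G → Set
HasRainbowCopy T G c = ∃[ φ ] (IsCopy T G φ × IsRainbow T G c φ)

module Submission where

-- The palette of a vertex is the list of colours of its k edges.
-- Suppose adjacent u, v have different palettes, so some edge v — z has a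
-- colour β missing at u.  Since T is not a star it contains a path
-- ℓ — p — q — r with ℓ a leaf.  Send p, q, r to u, v, z and embed the other
-- vertices except ℓ greedily along tree edges: fewer than k colours are in
-- use at each step, so a fresh colour is available, and the girth forces the
-- new image vertex to be new.  Finally attach ℓ at u: β is one of the at most
-- k colours used and is missing at u, so again a fresh colour exists.  The
-- result is a rainbow copy of T, which is excluded.  Hence, by connectivity,
-- every edge colour lies in the palette of one vertex, and numbering the
-- colours by their position in that palette gives a k-edge-colouring.

open import Defs hiding (sym)
open import Data.Nat using (ℕ; zero; suc; _+_; _≤_; _<_; z≤n; s≤s)
open import Data.Nat.Properties
  using (≤-reflexive; ≤-trans; ≤-<-trans; <⇒≱; ≤-pred; m≤n⇒m≤1+n; m≤n+m; n≤1+n;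
         +-comm; +-suc; +-identityʳ)
  renaming (_≟_ to _≟ℕ_)
open import Data.Nat.ListAction using (sum)
open import Data.Fin using (Fin; zero; suc; inject₁; fromℕ; fromℕ<; toℕ)
open import Data.Fin.Properties using (_≟_; any?; injective⇒≤; toℕ<n; toℕ-injective)
open import Data.Bool using (true; false; if_then_else_) renaming (_≟_ to _≟ᵇ_)
open import Data.List using (List; []; _∷_; length; map; lookup; allFin; filter)
open import Data.List.Properties using (length-map)
open import Data.List.Membership.Propositional using (_∈_; _∉_; find; lose)
open import Data.List.Membership.Propositional.Properties
  using (∈-lookup; ∈-allFin; ∈-map⁺; ∈-map⁻; ∈-filter⁺; ∈-filter⁻)
open import Data.List.Membership.Setoid.Properties using (index-injective)
import Data.List.Membership.DecPropositional as DecMembership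
open import Data.List.Relation.Binary.Subset.Propositional using (_⊆_)
open import Data.List.Relation.Unary.Any using (here; there; index)
import Data.List.Relation.Unary.Any as Any
open import Data.List.Relation.Unary.All using (All; []; _∷_)
import Data.List.Relation.Unary.All as All
open import Data.List.Relation.Unary.All.Properties using (¬Any⇒All¬; all-filter)
open import Data.List.Relation.Unary.AllPairs using ([]; _∷_)
open import Data.List.Relation.Unary.Unique.Propositional using (Unique)
open import Data.List.Relation.Unary.Unique.Propositional.Properties using (allFin⁺; filter⁺)
open import Data.Product using (Σ; ∃; _×_; _,_; proj₁; proj₂)
open import Data.Sum using (_⊎_; inj₁; inj₂)
open import Data.Empty using (⊥-elim)
open import Function.Bundles using (mk⇔)
open import Function.Definitions using (Injective)
open import Relation.Nullary using (¬_; Dec; yes; no)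
open import Relation.Nullary.Decidable using (¬?; _×-dec_; decidable-stable)
open import Relation.Binary.PropositionalEquality
  using (_≡_; _≢_; refl; sym; trans; cong; cong₂; subst; subst₂; setoid)

module _ {A : Set} where

  lookup-injective : ∀ {xs : List A} → Unique xs → Injective _≡_ _≡_ (lookup xs)
  lookup-injective (_ ∷ _) {zero} {zero} _ = refl
  lookup-injective (x∉xs ∷ _) {zero} {suc j} x≡ = ⊥-elim (All.lookup x∉xs (∈-lookup j) x≡)
  lookup-injective (x∉xs ∷ _) {suc i} {zero} ≡x = ⊥-elim (All.lookup x∉xs (∈-lookup i) (sym ≡x))
  lookup-injective (_ ∷ u) {suc i} {suc j} e = cong suc (lookup-injective u e)

  ⊆-length : ∀ {xs ys : List A} → Unique xs → xs ⊆ ys → length xs ≤ length ys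
  ⊆-length {xs} u xs⊆ys = injective⇒≤ λ {i} {j} e →
    lookup-injective u (index-injective (setoid A) (xs⊆ys (∈-lookup i)) (xs⊆ys (∈-lookup j)) e)

unique-Fin-length : ∀ {m} {xs : List (Fin m)} → Unique xs → length xs ≤ m
unique-Fin-length u = injective⇒≤ (lookup-injective u)

complete-Fin-length : ∀ {m} {xs : List (Fin m)} → (∀ y → y ∈ xs) → m ≤ length xs
complete-Fin-length all = injective⇒≤ (index-injective (setoid _) (all _) (all _))

module _ {A B : Set} {P : A → Set} {f : A → B}
         (f-inj : ∀ {x y} → P x → P y → f x ≡ f y → x ≡ y) where

  map-unique : ∀ {xs} → All P xs → Unique xs → Unique (map f xs)
  map-unique [] [] = []
  map-unique {x ∷ _} (px ∷ pxs) (x∉xs ∷ u) = image-fresh pxs x∉xs ∷ map-unique pxs u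
    where
      image-fresh : ∀ {ys} → All P ys → All (x ≢_) ys → All (f x ≢_) (map f ys)
      image-fresh [] [] = []
      image-fresh (py ∷ pys) (x≢y ∷ x≢ys) = (λ e → x≢y (f-inj px py e)) ∷ image-fresh pys x≢ys

adj-sym : (H : Graph) {u v : Fin (n H)} → Adj H u v → Adj H v u
adj-sym H {u} {v} uv = trans (sym (Graph.sym H u v)) uv

adj-irrefl : (H : Graph) {u : Fin (n H)} → ¬ Adj H u u
adj-irrefl H {u} uu with trans (sym uu) (irrefl H u)
... | ()

adj? : (H : Graph) (u v : Fin (n H)) → Dec (Adj H u v)
adj? H u v = adj H u v ≟ᵇ true

data Path (H : Graph) : Fin (n H) → Fin (n H) → List (Fin (n H)) → Set where
  []  : ∀ {x} → Path H x x []
  _∷_ : ∀ {x w y ws} → Adj H x w → Path H w y ws → Path H x y (w ∷ ws)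

module _ {H : Graph} where

  path-steps : ∀ {x y ws} → Path H x y ws → (i : Fin (length ws)) →
    Adj H (lookup (x ∷ ws) (inject₁ i)) (lookup (x ∷ ws) (suc i))
  path-steps (xw ∷ _) zero = xw
  path-steps (_ ∷ p) (suc i) = path-steps p i

  path-end : ∀ {x y ws} → Path H x y ws → lookup (x ∷ ws) (fromℕ (length ws)) ≡ y
  path-end [] = refl
  path-end (_ ∷ p) = path-end p

  path⇒cycle : ∀ {x y ws} → Path H x y ws → Unique (x ∷ ws) → Adj H y x →
    CycleOfLength H (suc (length ws))
  path⇒cycle {x} {ws = ws} p u yx =
    lookup (x ∷ ws) , lookup-injective u , path-steps p ,
    subst (λ z → Adj H z x) (sym (path-end p)) yx

map-path : ∀ {H H' : Graph} {P : Fin (n H) → Set} (f : Fin (n H) → Fin (n H')) →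
  (∀ {a b} → P a → P b → Adj H a b → Adj H' (f a) (f b)) →
  ∀ {x y ws} → Path H x y ws → All P (x ∷ ws) → Path H' (f x) (f y) (map f ws)
map-path f hom [] _ = []
map-path f hom (xw ∷ p) (px ∷ pw ∷ ps) = hom px pw xw ∷ map-path f hom p (pw ∷ ps)

module ConnectedSets (H : Graph) where

  private
    V = Fin (n H)
  open DecMembership (_≟_ {n = n H}) using (_∈?_)

  data WalkIn (S : List V) : V → V → Set where
    []   : ∀ {x} → WalkIn S x x
    step : ∀ {x w y} → Adj H x w → w ∈ S → WalkIn S w y → WalkIn S x y

  walk-weaken : ∀ {S t x y} → WalkIn S x y → WalkIn (t ∷ S) x y
  walk-weaken [] = []
  walk-weaken (step xw w∈S walk) = step xw (there w∈S) (walk-weaken walk)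

  walk-append : ∀ {S x y z} → WalkIn S x y → WalkIn S y z → WalkIn S x z
  walk-append [] walk' = walk'
  walk-append (step xw w∈S walk) walk' = step xw w∈S (walk-append walk walk')

  ConnectedSet : List V → Set
  ConnectedSet S = ∀ {x y} → x ∈ S → y ∈ S → WalkIn S x y

  singleton-connected : ∀ {x} → ConnectedSet (x ∷ [])
  singleton-connected (here refl) (here refl) = []

  connected-grow : ∀ {S p t} → ConnectedSet S → p ∈ S → Adj H p t → ConnectedSet (t ∷ S)
  connected-grow conn p∈S pt (here refl) (here refl) = []
  connected-grow conn p∈S pt (here refl) (there y∈S) =
    step (adj-sym H pt) (there p∈S) (walk-weaken (conn p∈S y∈S))
  connected-grow conn p∈S pt (there x∈S) (here refl) =
    walk-append (walk-weaken (conn x∈S p∈S)) (step pt (here refl) [])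
  connected-grow conn p∈S pt (there x∈S) (there y∈S) = walk-weaken (conn x∈S y∈S)

  record PathIn (S : List V) (x y : V) : Set where
    constructor pathIn
    field
      vertices : List V
      path     : Path H x y vertices
      unique   : Unique (x ∷ vertices)
      inside   : All (_∈ S) (x ∷ vertices)

  private
    drop-to : ∀ {S x a y ws} → x ∈ (a ∷ ws) → Path H a y ws → Unique (a ∷ ws) →
      All (_∈ S) (a ∷ ws) → PathIn S x y
    drop-to (here refl) p u inS = pathIn _ p u inS
    drop-to (there x∈ws) (_ ∷ p) (_ ∷ u) (_ ∷ inS) = drop-to x∈ws p u inS

  -- Every walk inside S can be shortened to a path inside S, by cutting out
  -- the segment between two visits of a repeated vertex.
  shortcut : ∀ {S x y} → x ∈ S → WalkIn S x y → PathIn S x y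
  shortcut x∈S [] = pathIn [] [] ([] ∷ []) (x∈S ∷ [])
  shortcut {x = x} x∈S (step {w = w} xw w∈S walk) with shortcut w∈S walk
  ... | pathIn ws p u inS with x ∈? (w ∷ ws)
  ...   | yes x∈ = drop-to x∈ p u inS
  ...   | no x∉ = pathIn (w ∷ ws) (xw ∷ p) (¬Any⇒All¬ _ x∉ ∷ u) (x∈S ∷ inS)

  path-nonempty : ∀ {x y ws} → Path H x y ws → x ≢ y → 1 ≤ length ws
  path-nonempty [] x≢x = ⊥-elim (x≢x refl)
  path-nonempty (_ ∷ _) _ = s≤s z≤n

  -- In an acyclic graph a vertex outside a connected set S has at most one
  -- neighbour in S: two of them would close a cycle through S.
  unique-neighbour : Acyclic H → ∀ {S t p p'} → ConnectedSet S → t ∉ S → p ∈ S → p' ∈ S →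
    Adj H t p → Adj H t p' → p ≡ p'
  unique-neighbour acyclic {S} {t} {p} {p'} conn t∉S p∈S p'∈S tp tp' with p ≟ p'
  ... | yes p≡p' = p≡p'
  ... | no p≢p' with shortcut p∈S (conn p∈S p'∈S)
  ...   | pathIn ws path u inS =
    ⊥-elim (acyclic _ (s≤s (s≤s (path-nonempty path p≢p')))
      (path⇒cycle (tp ∷ path) (outside inS ∷ u) (adj-sym H tp')))
    where
      outside : ∀ {xs} → All (_∈ S) xs → All (t ≢_) xs
      outside [] = []
      outside (x∈S ∷ xs∈S) = (λ { refl → t∉S x∈S }) ∷ outside xs∈S

  record BoundaryEdge (S : List V) : Set where
    constructor boundaryEdge
    field
      {inner outer} : V
      inner∈S : inner ∈ S
      outer∉S : outer ∉ S
      edge    : Adj H inner outer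

  exit-edge : ∀ {S s x} → s ∈ S → Walk H s x → x ∉ S → BoundaryEdge S
  exit-edge s∈S here x∉S = ⊥-elim (x∉S s∈S)
  exit-edge {S} s∈S (step {w = w} sw walk) x∉S with w ∈? S
  ... | yes w∈S = exit-edge w∈S walk x∉S
  ... | no w∉S = boundaryEdge s∈S w∉S sw

record Leaf (T : Graph) : Set where
  field
    leaf parent : Fin (n T)
    parent-leaf : Adj T parent leaf
    only-parent : ∀ {w} → Adj T leaf w → w ≡ parent

module _ (m : ℕ) where
  open DecMembership (_≟_ {n = m}) using (_∈?_)

  missing? : (S : List (Fin m)) → Dec (∃ λ y → y ∉ S)
  missing? S = any? (λ y → ¬? (y ∈? S))

  nothing-missing : {S : List (Fin m)} → ¬ (∃ λ y → y ∉ S) → ∀ y → y ∈ S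
  nothing-missing {S} ¬missing y = decidable-stable (y ∈? S) (λ y∉S → ¬missing (y , y∉S))

-- A tree with at least two vertices has a leaf: grow a connected vertex set
-- one boundary vertex at a time; the vertex added last is a leaf.
module _ (T : Graph) (connected : Connected T) (acyclic : Acyclic T) where
  open ConnectedSets T

  private
    last-is-leaf : ∀ {S a b} → ConnectedSet S → b ∉ S → a ∈ S → Adj T a b →
      (∀ y → y ∈ b ∷ S) → ∀ {w} → Adj T b w → w ≡ a
    last-is-leaf conn b∉S a∈S ab covered {w} bw with covered w
    ... | here refl = ⊥-elim (adj-irrefl T bw)
    ... | there w∈S = unique-neighbour acyclic conn b∉S w∈S a∈S bw (adj-sym T ab)

    -- The fuel bounds the number of vertices still to be added.
    leaf-by-growth : ∀ {x₀} fuel S → n T ≤ length S + fuel → Unique S → ConnectedSet S →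
      x₀ ∈ S → (∃ λ x → x ∉ S) → Leaf T
    leaf-by-growth {x₀} fuel S room u conn x₀∈S (x , x∉S)
      with exit-edge x₀∈S (connected x₀ x) x∉S
    ... | boundaryEdge {a} {b} a∈S b∉S ab with missing? (n T) (b ∷ S) | fuel
    ...   | no ¬missing | _ = record
      { leaf = b ; parent = a ; parent-leaf = ab
      ; only-parent = last-is-leaf conn b∉S a∈S ab (nothing-missing (n T) ¬missing) }
    ...   | yes missing | suc fuel' =
      leaf-by-growth fuel' (b ∷ S) (≤-trans room (≤-reflexive (+-suc (length S) fuel')))
        (¬Any⇒All¬ S b∉S ∷ u) (connected-grow conn a∈S ab) (there x₀∈S) missing
    ...   | yes _ | zero = ⊥-elim (<⇒≱ (unique-Fin-length (¬Any⇒All¬ S x∉S ∷ u))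
      (≤-trans room (≤-reflexive (+-identityʳ (length S)))))

  find-leaf : 2 ≤ n T → Leaf T
  find-leaf 2≤n with missing? (n T) (x₀ ∷ [])
    where x₀ = fromℕ< {0} {n T} (≤-trans (s≤s z≤n) 2≤n)
  ... | yes missing = leaf-by-growth (n T) (_ ∷ []) (n≤1+n (n T)) ([] ∷ [])
    singleton-connected (here refl) missing
  ... | no ¬missing = ⊥-elim (<⇒≱ 2≤n (complete-Fin-length (nothing-missing (n T) ¬missing)))

record LeafPath (T : Graph) : Set where
  field
    ℓ p q r : Fin (n T)
    pℓ      : Adj T p ℓ
    ℓ-leaf  : ∀ {w} → Adj T ℓ w → w ≡ p
    pq      : Adj T p q
    qr      : Adj T q r
    r≢p     : r ≢ p

-- A connected graph in which no neighbour of p has a neighbour other than p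
-- is a star centred at p; so in a tree that is not a star, every leaf starts a LeafPath.
module _ (T : Graph) (connected : Connected T) where

  Branching : Fin (n T) → Set
  Branching p = ∃ λ q → Adj T p q × ∃ λ r → Adj T q r × r ≢ p

  branching? : ∀ p → Dec (Branching p)
  branching? p = any? (λ q → adj? T p q ×-dec any? (λ r → adj? T q r ×-dec ¬? (r ≟ p)))

  module _ {p : Fin (n T)} (¬branching : ¬ Branching p) where

    stays-near : ∀ {y x} → Walk T y x → y ≡ p ⊎ Adj T p y → x ≡ p ⊎ Adj T p x
    stays-near here near = near
    stays-near (step yw walk) (inj₁ refl) = stays-near walk (inj₂ yw)
    stays-near (step {w = w} yw walk) (inj₂ py) with w ≟ p
    ... | yes refl = stays-near walk (inj₁ refl)
    ... | no w≢p = ⊥-elim (¬branching (_ , py , w , yw , w≢p))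

    adjacent-to-centre : ∀ u → u ≢ p → Adj T p u
    adjacent-to-centre u u≢p with stays-near (connected p u) (inj₁ refl)
    ... | inj₁ u≡p = ⊥-elim (u≢p u≡p)
    ... | inj₂ pu = pu

    star-at : IsStar T
    star-at = p , λ u v → mk⇔ (edge-at-centre u v) (centre-edge u v)
      where
        edge-at-centre : ∀ u v → Adj T u v → u ≢ v × (u ≡ p ⊎ v ≡ p)
        edge-at-centre u v uv with u ≟ p | v ≟ p
        ... | yes u≡p | _ = (λ { refl → adj-irrefl T uv }) , inj₁ u≡p
        ... | no _ | yes v≡p = (λ { refl → adj-irrefl T uv }) , inj₂ v≡p
        ... | no u≢p | no v≢p = ⊥-elim (¬branching (u , adjacent-to-centre u u≢p , v , uv , v≢p))
        centre-edge : ∀ u v → u ≢ v × (u ≡ p ⊎ v ≡ p) → Adj T u v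
        centre-edge u v (u≢v , inj₁ refl) = adjacent-to-centre v (λ v≡u → u≢v (sym v≡u))
        centre-edge u v (u≢v , inj₂ refl) = adj-sym T (adjacent-to-centre u u≢v)

  leaf-path : Leaf T → ¬ IsStar T → LeafPath T
  leaf-path leaf ¬star with branching? (Leaf.parent leaf)
  ... | yes (q , pq , r , qr , r≢p) = record
    { ℓ = Leaf.leaf leaf ; p = Leaf.parent leaf ; q = q ; r = r
    ; pℓ = Leaf.parent-leaf leaf ; ℓ-leaf = Leaf.only-parent leaf
    ; pq = pq ; qr = qr ; r≢p = r≢p }
  ... | no ¬branching = ⊥-elim (¬star (star-at ¬branching))

vertex? : (m : ℕ) → Fin m ⊎ ¬ Fin m
vertex? zero = inj₂ λ ()
vertex? (suc m) = inj₁ zero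

module Palettes (G : Graph) (c : Colouring G) (proper : IsProper G c) where

  private
    V = Fin (n G)
  open DecMembership _≟ℕ_ using (_∈?_)

  neighbours : V → List V
  neighbours u = filter (adj? G u) (allFin (n G))

  palette : V → List ℕ
  palette u = map (c u) (neighbours u)

  count-neighbours : ∀ u xs →
    length (filter (adj? G u) xs) ≡ sum (map (λ v → if adj G u v then 1 else 0) xs)
  count-neighbours u [] = refl
  count-neighbours u (x ∷ xs) with adj G u x
  ... | true = cong suc (count-neighbours u xs)
  ... | false = count-neighbours u xs

  palette-length : ∀ u → length (palette u) ≡ deg G u
  palette-length u = trans (length-map (c u) (neighbours u)) (count-neighbours u (allFin (n G)))

  colour-injective : ∀ {u v w} → Adj G u v → Adj G u w → c u v ≡ c u w → v ≡ w
  colour-injective {u} {v} {w} uv uw same with v ≟ w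
  ... | yes v≡w = v≡w
  ... | no v≢w = ⊥-elim (proj₂ proper u v w uv uw v≢w same)

  palette-unique : ∀ u → Unique (palette u)
  palette-unique u =
    map-unique colour-injective (all-filter (adj? G u) (allFin (n G))) (filter⁺ (adj? G u) (allFin⁺ (n G)))

  ∈-palette : ∀ {u w} → Adj G u w → c u w ∈ palette u
  ∈-palette {u} {w} uw = ∈-map⁺ (c u) (∈-filter⁺ (adj? G u) (∈-allFin w) uw)

  palette-∈ : ∀ {u γ} → γ ∈ palette u → ∃ λ w → Adj G u w × γ ≡ c u w
  palette-∈ {u} γ∈ with ∈-map⁻ (c u) γ∈
  ... | w , w∈ , γ≡ = w , proj₂ (∈-filter⁻ (adj? G u) {xs = allFin (n G)} w∈) , γ≡

  fresh-edge : ∀ u U → ¬ (palette u ⊆ U) → ∃ λ w → Adj G u w × c u w ∉ U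
  fresh-edge u U palette⊈U with Any.any? (λ γ → ¬? (γ ∈? U)) (palette u)
  ... | no none = ⊥-elim (palette⊈U λ {γ} γ∈ →
    decidable-stable (γ ∈? U) (λ γ∉U → none (lose γ∈ γ∉U)))
  ... | yes some with find some
  ...   | γ , γ∈ , γ∉U with palette-∈ γ∈
  ...     | w , uw , refl = w , uw , γ∉U

  fresh-edge-short : ∀ u U → length U < deg G u → ∃ λ w → Adj G u w × c u w ∉ U
  fresh-edge-short u U short = fresh-edge u U λ palette⊆U →
    <⇒≱ short (≤-trans (≤-reflexive (sym (palette-length u))) (⊆-length (palette-unique u) palette⊆U))

  fresh-edge-spare : ∀ u U {β} → β ∈ U → β ∉ palette u → length U ≤ deg G u →
    ∃ λ w → Adj G u w × c u w ∉ U
  fresh-edge-spare u U β∈U β∉ small = fresh-edge u U λ palette⊆U →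
    <⇒≱ (s≤s (≤-reflexive (sym (palette-length u))))
      (≤-trans (⊆-length (¬Any⇒All¬ (palette u) β∉ ∷ palette-unique u)
                          (λ { (here refl) → β∈U ; (there γ∈) → palette⊆U γ∈ })) small)

  walk-⊆ : (∀ {u v} → Adj G u v → palette v ⊆ palette u) →
    ∀ {x y} → Walk G x y → palette y ⊆ palette x
  walk-⊆ edge-⊆ here = λ γ∈ → γ∈
  walk-⊆ edge-⊆ (step xw walk) = λ γ∈ → edge-⊆ xw (walk-⊆ edge-⊆ walk γ∈)

  -- In a connected k-regular graph whose adjacent vertices have nested
  -- palettes, all edge colours lie in one list of at most k colours (the
  -- palette of any vertex, or the empty list if there is none).
  common-palette : ∀ {k} → Regular k G → Connected G →
    (∀ {u v} → Adj G u v → palette v ⊆ palette u) →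
    ∃ λ L → length L ≤ k × (∀ u v → Adj G u v → c u v ∈ L)
  common-palette {k} regular connected edge-⊆ with vertex? (n G)
  ... | inj₁ x₀ = palette x₀ , ≤-reflexive (trans (palette-length x₀) (regular x₀)) ,
    λ u v uv → walk-⊆ edge-⊆ (connected x₀ u) (∈-palette uv)
  ... | inj₂ no-vertex = [] , z≤n , λ u _ _ → ⊥-elim (no-vertex u)

module Embeddings (T G : Graph) (acyclic : Acyclic T) (c : Colouring G) (proper : IsProper G c) where

  open ConnectedSets T public
  private
    VT = Fin (n T)
    VG = Fin (n G)

  colour-sym : ∀ {u v} → Adj G u v → c u v ≡ c v u
  colour-sym {u} {v} uv = proj₁ proper u v uv

  record RainbowEmbedding (S : List VT) (φ : VT → VG) (U : List ℕ) : Set where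
    field
      unique-S     : Unique S
      connected-S  : ConnectedSet S
      injective    : ∀ {x y} → x ∈ S → y ∈ S → φ x ≡ φ y → x ≡ y
      homomorphic  : ∀ {x y} → x ∈ S → y ∈ S → Adj T x y → Adj G (φ x) (φ y)
      rainbow      : ∀ {a b a' b'} → a ∈ S → b ∈ S → a' ∈ S → b' ∈ S →
                     Adj T a b → Adj T a' b' → c (φ a) (φ b) ≡ c (φ a') (φ b') →
                     (a ≡ a' × b ≡ b') ⊎ (a ≡ b' × b ≡ a')
      unique-U     : Unique U
      colours-in-U : ∀ {x y} → x ∈ S → y ∈ S → Adj T x y → c (φ x) (φ y) ∈ U
      edge-count   : suc (length U) ≡ length S

  single : ∀ x u → RainbowEmbedding (x ∷ []) (λ _ → u) []
  single x u = record
    { unique-S = [] ∷ []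
    ; connected-S = singleton-connected
    ; injective = λ { (here refl) (here refl) _ → refl }
    ; homomorphic = λ { (here refl) (here refl) xx → ⊥-elim (adj-irrefl T xx) }
    ; rainbow = λ { (here refl) (here refl) _ _ xx _ _ → ⊥-elim (adj-irrefl T xx) }
    ; unique-U = []
    ; colours-in-U = λ { (here refl) (here refl) xx → ⊥-elim (adj-irrefl T xx) }
    ; edge-count = refl
    }

  complete⇒copy : ∀ {S φ U} → RainbowEmbedding S φ U → (∀ x → x ∈ S) → HasRainbowCopy T G c
  complete⇒copy {φ = φ} emb covers = φ ,
    ((λ {a} {b} e → injective (covers a) (covers b) e) ,
     (λ a b ab → homomorphic (covers a) (covers b) ab)) ,
    λ a b a' b' ab a'b' same → rainbow (covers a) (covers b) (covers a') (covers b') ab a'b' same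
    where open RainbowEmbedding emb

  -- A vertex w reached from φ p along an unused colour lies outside the image
  -- of S when S is smaller than the girth of G.  Otherwise, say w = φ s, the
  -- path in S from s to p maps to a path which the edge φ p — w closes into a
  -- cycle shorter than the girth; the degenerate cases are s = p (a loop) and
  -- s ~ p (then φ p — w is an edge of the embedding, whose colour is used).
  image-avoids : ∀ {g S φ U p w s} → GirthAtLeast g G → length S < g → RainbowEmbedding S φ U →
    p ∈ S → Adj G (φ p) w → c (φ p) w ∉ U → s ∈ S → φ s ≢ w
  image-avoids {g} {S} {φ} {U} {p} {w} {s} girth small emb p∈S pw γ∉U s∈S φs≡w
    with shortcut s∈S (connected-S s∈S p∈S)
    where open RainbowEmbedding emb
  ... | pathIn [] [] _ _ = adj-irrefl G (subst (λ z → Adj G (φ p) z) (sym φs≡w) pw)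
  ... | pathIn (_ ∷ []) (sp ∷ []) _ _ = γ∉U (subst (_∈ U) colour-sp≡γ (colours-in-U s∈S p∈S sp))
    where
      open RainbowEmbedding emb
      colour-sp≡γ : c (φ s) (φ p) ≡ c (φ p) w
      colour-sp≡γ = trans (cong (λ z → c z (φ p)) φs≡w) (sym (colour-sym pw))
  ... | pathIn ws@(_ ∷ _ ∷ _) path u inS =
    girth _ (s≤s (s≤s (s≤s z≤n))) short-cycle
      (path⇒cycle (map-path {T} {G} φ homomorphic path inS) (map-unique injective inS u)
        (subst (λ z → Adj G (φ p) z) (sym φs≡w) pw))
    where
      open RainbowEmbedding emb
      short-cycle : suc (length (map φ ws)) < g
      short-cycle = ≤-<-trans (≤-reflexive (cong suc (length-map φ ws)))
        (≤-<-trans (⊆-length u (λ x∈ → All.lookup inS x∈)) small)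

  _[_↦_] : (VT → VG) → VT → VG → VT → VG
  (φ [ t ↦ w ]) x with x ≟ t
  ... | yes _ = w
  ... | no _ = φ x

  update-here : ∀ φ t w → (φ [ t ↦ w ]) t ≡ w
  update-here φ t w with t ≟ t
  ... | yes _ = refl
  ... | no t≢t = ⊥-elim (t≢t refl)

  update-there : ∀ φ t w {x} → x ≢ t → (φ [ t ↦ w ]) x ≡ φ x
  update-there φ t w {x} x≢t with x ≟ t
  ... | yes x≡t = ⊥-elim (x≢t x≡t)
  ... | no _ = refl

  module Extension {g S φ U} (girth : GirthAtLeast g G) (small : length S < g)
    (emb : RainbowEmbedding S φ U) {t p w} (t∉S : t ∉ S) (p∈S : p ∈ S) (pt : Adj T p t)
    (pw : Adj G (φ p) w) (γ∉U : c (φ p) w ∉ U) where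

    open RainbowEmbedding emb

    γ : ℕ
    γ = c (φ p) w

    φ' : VT → VG
    φ' = φ [ t ↦ w ]

    φ'-old : ∀ {x} → x ∈ S → φ' x ≡ φ x
    φ'-old x∈S = update-there φ t w (λ { refl → t∉S x∈S })

    φ'-new : φ' t ≡ w
    φ'-new = update-here φ t w

    data EdgeIn : VT → VT → Set where
      old : ∀ {a b} → a ∈ S → b ∈ S → EdgeIn a b
      new-tp : EdgeIn t p
      new-pt : EdgeIn p t

    classify : ∀ {a b} → a ∈ t ∷ S → b ∈ t ∷ S → Adj T a b → EdgeIn a b
    classify (here refl) (here refl) tt = ⊥-elim (adj-irrefl T tt)
    classify (here refl) (there b∈S) tb
      with refl ← unique-neighbour acyclic connected-S t∉S b∈S p∈S tb (adj-sym T pt) = new-tp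
    classify (there a∈S) (here refl) at
      with refl ← unique-neighbour acyclic connected-S t∉S a∈S p∈S (adj-sym T at) (adj-sym T pt) = new-pt
    classify (there a∈S) (there b∈S) _ = old a∈S b∈S

    old-colour : ∀ {x y} → x ∈ S → y ∈ S → c (φ' x) (φ' y) ≡ c (φ x) (φ y)
    old-colour x∈S y∈S = cong₂ c (φ'-old x∈S) (φ'-old y∈S)

    colour-tp : c (φ' t) (φ' p) ≡ γ
    colour-tp = trans (cong₂ c φ'-new (φ'-old p∈S)) (sym (colour-sym pw))

    colour-pt : c (φ' p) (φ' t) ≡ γ
    colour-pt = cong₂ c (φ'-old p∈S) φ'-new

    old-not-γ : ∀ {x y} → x ∈ S → y ∈ S → Adj T x y → c (φ' x) (φ' y) ≢ γ
    old-not-γ x∈S y∈S xy same =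
      γ∉U (subst (_∈ U) (trans (sym (old-colour x∈S y∈S)) same) (colours-in-U x∈S y∈S xy))

    fresh : ∀ {s} → s ∈ S → φ' s ≢ φ' t
    fresh s∈S same =
      image-avoids girth small emb p∈S pw γ∉U s∈S (trans (sym (φ'-old s∈S)) (trans same φ'-new))

    injective' : ∀ {x y} → x ∈ t ∷ S → y ∈ t ∷ S → φ' x ≡ φ' y → x ≡ y
    injective' (here refl) (here refl) _ = refl
    injective' (here refl) (there y∈S) same = ⊥-elim (fresh y∈S (sym same))
    injective' (there x∈S) (here refl) same = ⊥-elim (fresh x∈S same)
    injective' (there x∈S) (there y∈S) same =
      injective x∈S y∈S (trans (sym (φ'-old x∈S)) (trans same (φ'-old y∈S)))

    homomorphic' : ∀ {a b} → EdgeIn a b → Adj T a b → Adj G (φ' a) (φ' b)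
    homomorphic' (old a∈S b∈S) ab =
      subst₂ (Adj G) (sym (φ'-old a∈S)) (sym (φ'-old b∈S)) (homomorphic a∈S b∈S ab)
    homomorphic' new-tp _ = subst₂ (Adj G) (sym φ'-new) (sym (φ'-old p∈S)) (adj-sym G pw)
    homomorphic' new-pt _ = subst₂ (Adj G) (sym (φ'-old p∈S)) (sym φ'-new) pw

    rainbow' : ∀ {a b a' b'} → EdgeIn a b → EdgeIn a' b' → Adj T a b → Adj T a' b' →
      c (φ' a) (φ' b) ≡ c (φ' a') (φ' b') → (a ≡ a' × b ≡ b') ⊎ (a ≡ b' × b ≡ a')
    rainbow' (old a∈S b∈S) (old a'∈S b'∈S) ab a'b' same =
      rainbow a∈S b∈S a'∈S b'∈S ab a'b'
        (trans (sym (old-colour a∈S b∈S)) (trans same (old-colour a'∈S b'∈S)))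
    rainbow' (old a∈S b∈S) new-tp ab _ same = ⊥-elim (old-not-γ a∈S b∈S ab (trans same colour-tp))
    rainbow' (old a∈S b∈S) new-pt ab _ same = ⊥-elim (old-not-γ a∈S b∈S ab (trans same colour-pt))
    rainbow' new-tp (old a'∈S b'∈S) _ a'b' same =
      ⊥-elim (old-not-γ a'∈S b'∈S a'b' (trans (sym same) colour-tp))
    rainbow' new-pt (old a'∈S b'∈S) _ a'b' same =
      ⊥-elim (old-not-γ a'∈S b'∈S a'b' (trans (sym same) colour-pt))
    rainbow' new-tp new-tp _ _ _ = inj₁ (refl , refl)
    rainbow' new-tp new-pt _ _ _ = inj₂ (refl , refl)
    rainbow' new-pt new-tp _ _ _ = inj₂ (refl , refl)
    rainbow' new-pt new-pt _ _ _ = inj₁ (refl , refl)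

    colour-in : ∀ {a b} → EdgeIn a b → Adj T a b → c (φ' a) (φ' b) ∈ γ ∷ U
    colour-in (old a∈S b∈S) ab = there (subst (_∈ U) (sym (old-colour a∈S b∈S)) (colours-in-U a∈S b∈S ab))
    colour-in new-tp _ = here colour-tp
    colour-in new-pt _ = here colour-pt

    extended : RainbowEmbedding (t ∷ S) φ' (γ ∷ U)
    extended = record
      { unique-S = ¬Any⇒All¬ S t∉S ∷ unique-S
      ; connected-S = connected-grow connected-S p∈S pt
      ; injective = injective'
      ; homomorphic = λ a∈ b∈ ab → homomorphic' (classify a∈ b∈ ab) ab
      ; rainbow = λ a∈ b∈ a'∈ b'∈ ab a'b' →
          rainbow' (classify a∈ b∈ ab) (classify a'∈ b'∈ a'b') ab a'b'
      ; unique-U = ¬Any⇒All¬ U γ∉U ∷ unique-U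
      ; colours-in-U = λ a∈ b∈ ab → colour-in (classify a∈ b∈ ab) ab
      ; edge-count = cong suc edge-count
      }

  extend : ∀ {g S φ U t p w} → GirthAtLeast g G → length S < g → RainbowEmbedding S φ U →
    t ∉ S → p ∈ S → Adj T p t → Adj G (φ p) w → c (φ p) w ∉ U →
    RainbowEmbedding (t ∷ S) (φ [ t ↦ w ]) (c (φ p) w ∷ U)
  extend girth small emb t∉S p∈S pt pw γ∉U = Extension.extended girth small emb t∉S p∈S pt pw γ∉U

module Discrepancy (k : ℕ) (T G : Graph) (size : n T ≡ k + 2) (connected : Connected T)
  (acyclic : Acyclic T) (leafPath : LeafPath T) (regular : Regular k G)
  (girth : GirthAtLeast (k + 2) G) (c : Colouring G) (proper : IsProper G c) where

  open Embeddings T G acyclic c proper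
  open Palettes G c proper
  open LeafPath leafPath
  open DecMembership _≟ℕ_ using (_∈?_)
  private
    VT = Fin (n T)
    VG = Fin (n G)

  size' : n T ≡ suc (suc k)
  size' = trans size (+-comm k 2)

  without-one : ∀ {a S} → Unique (a ∷ S) → length S ≤ suc k
  without-one {S = S} u = ≤-pred (subst (suc (length S) ≤_) size' (unique-Fin-length u))

  without-two : ∀ {a b S} → Unique (a ∷ b ∷ S) → length S ≤ k
  without-two {S = S} u =
    ≤-pred (≤-pred (subst (suc (suc (length S)) ≤_) size' (unique-Fin-length u)))

  below-girth : ∀ {m} → m ≤ suc k → m < k + 2
  below-girth {m} m≤ = subst (m <_) (sym (+-comm k 2)) (s≤s m≤)

  -- Every vertex outside S other than the leaf ℓ is reached from S by an edge
  -- avoiding ℓ, since ℓ hangs off p ∈ S.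
  exit-avoiding-leaf : ∀ {S x} → p ∈ S → x ∉ S → x ≢ ℓ →
    Σ (BoundaryEdge S) λ e → BoundaryEdge.outer e ≢ ℓ
  exit-avoiding-leaf {S} {x} p∈S x∉S x≢ℓ
    with exit-edge (there p∈S) (connected p x)
           (λ { (here x≡ℓ) → x≢ℓ x≡ℓ ; (there x∈S) → x∉S x∈S })
  ... | boundaryEdge (here refl) b∉ ℓb = ⊥-elim (b∉ (there (subst (_∈ S) (sym (ℓ-leaf ℓb)) p∈S)))
  ... | boundaryEdge (there a∈S) b∉ ab =
    boundaryEdge a∈S (λ b∈S → b∉ (there b∈S)) ab , λ b≡ℓ → b∉ (here b≡ℓ)

  record Stage (u : VG) (β : ℕ) : Set where
    field
      {S}   : List VT
      {φ}   : VT → VG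
      {U}   : List ℕ
      embedding : RainbowEmbedding S φ U
      ℓ∉S   : ℓ ∉ S
      p∈S   : p ∈ S
      p↦u   : φ p ≡ u
      β-used : β ∈ U
    open RainbowEmbedding embedding public

  module _ {u : VG} {β : ℕ} (β∉ : β ∉ palette u) where

    -- Once everything but ℓ is embedded, at most k colours are used, β among
    -- them, so some edge at u carries an unused colour; attach ℓ along it.
    attach-leaf : (st : Stage u β) → (∀ x → x ∈ ℓ ∷ Stage.S st) → HasRainbowCopy T G c
    attach-leaf st covered = attach
      (fresh-edge-spare (φ p) U β-used (subst (λ y → β ∉ palette y) (sym p↦u) β∉) few-colours)
      where
        open Stage st
        S-size : length S ≤ suc k
        S-size = without-one (¬Any⇒All¬ S ℓ∉S ∷ unique-S)
        few-colours : length U ≤ deg G (φ p)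
        few-colours = subst (length U ≤_) (sym (regular (φ p)))
          (≤-pred (subst (_≤ suc k) (sym edge-count) S-size))
        attach : (∃ λ w → Adj G (φ p) w × c (φ p) w ∉ U) → HasRainbowCopy T G c
        attach (w , pw , γ∉U) =
          complete⇒copy (extend girth (below-girth S-size) embedding ℓ∉S p∈S pℓ pw γ∉U) covered

    -- While a vertex other than ℓ is missing from S, the stage is extended
    -- across an edge leaving S that avoids ℓ; then S has at most k vertices, so
    -- fewer than k colours are used and an edge with a fresh colour exists.
    module _ (st : Stage u β) (e : BoundaryEdge (Stage.S st)) (b≢ℓ : BoundaryEdge.outer e ≢ ℓ) where
      open Stage st
      open BoundaryEdge e

      S-small : length S ≤ k
      S-small =
        without-two (((λ ℓ≡b → b≢ℓ (sym ℓ≡b)) ∷ ¬Any⇒All¬ S ℓ∉S) ∷ ¬Any⇒All¬ S outer∉S ∷ unique-S)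

      extend-stage : Stage u β
      extend-stage = along (fresh-edge-short (φ inner) U few-colours)
        where
          few-colours : length U < deg G (φ inner)
          few-colours = subst (suc (length U) ≤_) (sym (regular (φ inner)))
            (subst (_≤ k) (sym edge-count) S-small)
          along : (∃ λ w → Adj G (φ inner) w × c (φ inner) w ∉ U) → Stage u β
          along (w , aw , γ∉U) = record
            { embedding =
                extend girth (below-girth (m≤n⇒m≤1+n S-small)) embedding outer∉S inner∈S edge aw γ∉U
            ; ℓ∉S = λ { (here ℓ≡b) → b≢ℓ (sym ℓ≡b) ; (there ℓ∈S) → ℓ∉S ℓ∈S }
            ; p∈S = there p∈S
            ; p↦u = trans (update-there φ outer w (λ { refl → outer∉S p∈S })) p↦u
            ; β-used = there β-used
            }

    grow : ∀ fuel (st : Stage u β) → suc k ≤ length (Stage.S st) + fuel → HasRainbowCopy T G c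
    grow-along : ∀ fuel (st : Stage u β) → suc k ≤ length (Stage.S st) + fuel →
      Σ (BoundaryEdge (Stage.S st)) (λ e → BoundaryEdge.outer e ≢ ℓ) → HasRainbowCopy T G c

    grow fuel st room with missing? (n T) (ℓ ∷ Stage.S st)
    ... | no ¬missing = attach-leaf st (nothing-missing (n T) ¬missing)
    ... | yes (x , x∉) =
      grow-along fuel st room
        (exit-avoiding-leaf (Stage.p∈S st) (λ x∈S → x∉ (there x∈S)) (λ x≡ℓ → x∉ (here x≡ℓ)))

    grow-along zero st room (e , b≢ℓ) =
      ⊥-elim (<⇒≱ room (≤-trans (≤-reflexive (+-identityʳ _)) (S-small st e b≢ℓ)))
    grow-along (suc fuel) st room (e , b≢ℓ) =
      grow fuel (extend-stage st e b≢ℓ) (≤-trans room (≤-reflexive (+-suc _ fuel)))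

  -- The seed: p, q, r ↦ u, v, z, where the colour β of v — z is missing at u
  -- (so in particular differs from the colour of u — v).
  discrepancy⇒rainbow : 0 < k → ∀ {u v z} → Adj G u v → Adj G v z → c v z ∉ palette u →
    HasRainbowCopy T G c
  discrepancy⇒rainbow k>0 {u} {v} {z} uv vz β∉ = grow β∉ k seed (m≤n+m (suc k) 2)
    where
      q≢p : q ≢ p
      q≢p refl = adj-irrefl T pq
      r≢q : r ≢ q
      r≢q refl = adj-irrefl T qr
      ℓ∉rqp : ℓ ∉ r ∷ q ∷ p ∷ []
      ℓ∉rqp (here refl) = q≢p (ℓ-leaf (adj-sym T qr))
      ℓ∉rqp (there (here refl)) = r≢p (ℓ-leaf qr)
      ℓ∉rqp (there (there (here refl))) = adj-irrefl T pℓ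

      φ₁ : VT → VG
      φ₁ = (λ _ → u) [ q ↦ v ]
      φ₁q : φ₁ q ≡ v
      φ₁q = update-here (λ _ → u) q v
      β-at-q : c (φ₁ q) z ≡ c v z
      β-at-q = cong (λ y → c y z) φ₁q

      embed-qp : RainbowEmbedding (q ∷ p ∷ []) φ₁ (c u v ∷ [])
      embed-qp = extend girth (below-girth (s≤s z≤n)) (single p u)
        (λ { (here q≡p) → q≢p q≡p }) (here refl) pq uv λ ()

      new-colour : c (φ₁ q) z ∉ c u v ∷ []
      new-colour (here same) = β∉ (subst (_∈ palette u) (trans (sym same) β-at-q) (∈-palette uv))

      seed : Stage u (c v z)
      seed = record
        { embedding = extend girth (below-girth (s≤s k>0)) embed-qp
            (λ { (here r≡q) → r≢q r≡q ; (there (here r≡p)) → r≢p r≡p }) (here refl) qr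
            (subst (λ y → Adj G y z) (sym φ₁q) vz) new-colour
        ; ℓ∉S = ℓ∉rqp
        ; p∈S = there (there (here refl))
        ; p↦u = trans (update-there φ₁ r z (λ p≡r → r≢p (sym p≡r)))
                      (update-there (λ _ → u) q v (λ p≡q → q≢p (sym p≡q)))
        ; β-used = here (sym β-at-q)
        }

  palette-⊆ : 0 < k → ¬ HasRainbowCopy T G c → ∀ {u v} → Adj G u v → palette v ⊆ palette u
  palette-⊆ k>0 no-rainbow {u} uv {γ} γ∈ with γ ∈? palette u | palette-∈ γ∈
  ... | yes γ∈u | _ = γ∈u
  ... | no γ∉u | z , vz , refl = ⊥-elim (no-rainbow (discrepancy⇒rainbow k>0 uv vz γ∉u))

-- A proper edge colouring whose colours lie in a list L of length at most k
-- yields a k-edge-colouring: recolour each edge by the position of its colour in L.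
module _ (G : Graph) (c : Colouring G) (proper : IsProper G c) (L : List ℕ)
         (in-L : ∀ u v → Adj G u v → c u v ∈ L) where

  open DecMembership _≟ℕ_ using (_∈?_)

  position : ℕ → ℕ
  position γ with γ ∈? L
  ... | yes γ∈L = toℕ (index γ∈L)
  ... | no _ = 0

  position-< : ∀ {γ} → γ ∈ L → position γ < length L
  position-< {γ} γ∈L with γ ∈? L
  ... | yes γ∈L' = toℕ<n (index γ∈L')
  ... | no γ∉L = ⊥-elim (γ∉L γ∈L)

  position-injective : ∀ {γ δ} → γ ∈ L → δ ∈ L → position γ ≡ position δ → γ ≡ δ
  position-injective {γ} {δ} γ∈L δ∈L same with γ ∈? L | δ ∈? L
  ... | yes γ∈L' | yes δ∈L' = index-injective (setoid ℕ) γ∈L' δ∈L' (toℕ-injective same)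
  ... | no γ∉L | _ = ⊥-elim (γ∉L γ∈L)
  ... | _ | no δ∉L = ⊥-elim (δ∉L δ∈L)

  recolour-into : ∀ {k} → length L ≤ k → EdgeColourable k G
  recolour-into L≤k = (λ u v → position (c u v)) ,
    ((λ u v uv → cong position (proj₁ proper u v uv)) ,
     (λ u v w uv uw v≢w same → proj₂ proper u v w uv uw v≢w
        (position-injective (in-L u v uv) (in-L u w uw) same))) ,
    λ u v uv → ≤-trans (position-< (in-L u v uv)) L≤k

lemma3p1 : (k : ℕ) → 0 < k → (T G : Graph) →
    n T ≡ k + 2 → IsTree T → ¬ IsStar T →
    Regular k G → Connected G → GirthAtLeast (k + 2) G →
    Σ (Colouring G) (λ c → IsProper G c × ¬ HasRainbowCopy T G c) →
    EdgeColourable k G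
lemma3p1 k k>0 T G size (connectedT , acyclicT) ¬star regular connectedG girth (c , proper , no-rainbow) =
  let (L , L≤k , in-L) = common-palette regular connectedG adjacent-palettes
  in recolour-into G c proper L in-L L≤k
  where
    open Palettes G c proper
    leafPath : LeafPath T
    leafPath = leaf-path T connectedT
      (find-leaf T connectedT acyclicT (subst (2 ≤_) (sym size) (m≤n+m 2 k))) ¬star
    adjacent-palettes : ∀ {u v} → Adj G u v → palette v ⊆ palette u
    adjacent-palettes = Discrepancy.palette-⊆ k T G size connectedT acyclicT leafPath
      regular girth c proper k>0 no-rainbow
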